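{- If $(\mathsf{e},\alpha)$, $(\mathsf{e}',\beta)$, $(\mathsf{e}\wedge\mathsf{e}',\gamma)$ and $(\mathsf{e}\vee\mathsf{e}',\delta)$ are actual events, then $$\mathbb{P}(\mathsf{e}\vee\mathsf{e}',\delta)+\mathbb{P}(\mathsf{e}\wedge\mathsf{e}',\gamma)=_{\mathbb{R}}\mathbb{P}(\mathsf{e},\alpha)+\mathbb{P}(\mathsf{e}',\beta).$$
   Context: A potential event is a sequence $\mathsf{e}:\mathbb{N}^{+}\to\{0,1\}$; $(\mathsf{e}\wedge\mathsf{e}')(n)=\mathsf{e}(n)\mathsf{e}'(n)$, $(\mathsf{e}\vee\mathsf{e}')(n)=\mathsf{e}(n)+\mathsf{e}'(n)-\mathsf{e}(n)\mathsf{e}'(n)$. Define $\Phi(\mathsf{e})(n)=\frac{\sum_{i=1}^{n}\mathsf{e}(i)}{n}$. An actual event is a pair $(\mathsf{e},\gamma)$ with $\gamma:\mathbb{N}^{+}\to\mathbb{N}^{+}$ strictly increasing and $|\Phi(\mathsf{e})(\gamma(n)+i)-\Phi(\mathsf{e})(\gamma(n)+j)|\le\frac1n$ for all $n\in\mathbb{N}^{+}$, $i,j\in\mathbb{N}$; $\mathbb{P}(\mathsf{e},\gamma):=\Phi(\mathsf{e})\circ\gamma$. Bishop reals are sequences $x:\mathbb{N}^{+}\to\mathbb{Q}$ with $|x(n)-x(m)|\le\frac1n+\frac1m$; $x=_{\mathbb{R}}y$ iff $|x(n)-y(n)|\le\frac2n$ for all $n$; $(x+y)(n)=x(2n)+y(2n)$.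 -}

module Defs where

open import Data.Bool using (Bool; true; false; if_then_else_)
import Data.Bool as B
open import Data.Nat using (ℕ; zero; suc; _<_; _≤_; NonZero)
import Data.Nat as N
open import Data.Integer using (+_)
open import Data.Rational using (ℚ; _/_; ∣_∣; _-_; _+_; 0ℚ)
import Data.Rational as Q
open import Data.Product using (_×_)

-- Sequences indexed by ℕ⁺ are represented as functions on ℕ;
-- the value at 0 is irrelevant and all quantifiers range over n ≥ 1.

PotentialEvent : Set
PotentialEvent = ℕ → Bool

-- pointwise meet and join; on {0,1} these are e·e' and e + e' - e·e'
_∧ₑ_ : PotentialEvent → PotentialEvent → PotentialEvent
(e ∧ₑ e') n = e n B.∧ e' n

_∨ₑ_ : PotentialEvent → PotentialEvent → PotentialEvent
(e ∨ₑ e') n = e n B.∨ e' n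

val : Bool → ℕ
val b = if b then 1 else 0

count : PotentialEvent → ℕ → ℕ
count e zero = zero
count e (suc n) = val (e (suc n)) N.+ count e n

Φ : PotentialEvent → ℕ → ℚ
Φ e zero = 0ℚ
Φ e (suc n) = (+ count e (suc n)) / suc n

StrictlyIncreasingℕ⁺ : (ℕ → ℕ) → Set
StrictlyIncreasingℕ⁺ γ =
  (∀ n → .{{NonZero n}} → NonZero (γ n)) ×
  (∀ m n → .{{NonZero m}} → m < n → γ m < γ n)

IsActualEvent : PotentialEvent → (ℕ → ℕ) → Set
IsActualEvent e γ =
  StrictlyIncreasingℕ⁺ γ ×
  (∀ n → .{{_ : NonZero n}} → ∀ (i j : ℕ) →
     ∣ Φ e (γ n N.+ i) - Φ e (γ n N.+ j) ∣ Q.≤ (+ 1) / n)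

ℙ : PotentialEvent → (ℕ → ℕ) → (ℕ → ℚ)
ℙ e γ n = Φ e (γ n)

IsBishopReal : (ℕ → ℚ) → Set
IsBishopReal x = ∀ n m → .{{_ : NonZero n}} → .{{_ : NonZero m}} →
  ∣ x n - x m ∣ Q.≤ (+ 1) / n + (+ 1) / m

_=ℝ_ : (ℕ → ℚ) → (ℕ → ℚ) → Set
x =ℝ y = ∀ n → .{{_ : NonZero n}} → ∣ x n - y n ∣ Q.≤ (+ 2) / n

_+ℝ_ : (ℕ → ℚ) → (ℕ → ℚ) → (ℕ → ℚ)
(x +ℝ y) n = x (2 N.* n) + y (2 N.* n)

-- At any index M beyond α(2n), β(2n), γ(2n) and δ(2n), inclusion–exclusion holds exactly for the
-- frequencies: Φ(e ∨ e')(M) + Φ(e ∧ e')(M) = Φ(e)(M) + Φ(e')(M), since it already holds for the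
-- counts. Each of the four sampled values ℙ(·)(2n) lies within 1/(2n) of the corresponding frequency
-- at M, so the two sums differ by at most 4/(2n) = 2/n.
module Submission where

open import Defs
open import Data.Nat using (ℕ; zero; suc; NonZero)
import Data.Nat as N
import Data.Nat.Properties as NP
open import Algebra.Properties.CommutativeSemigroup NP.+-commutativeSemigroup using (interchange)
import Data.Nat.Solver as NS
open import Data.Bool using (true; false)
import Data.Bool as B
open import Data.Integer using (+_)
import Data.Integer as Z
import Data.Integer.Properties as ZP
open import Data.Integer.Solver renaming (module +-*-Solver to ZS)
open import Data.Rational using (ℚ; _/_; ∣_∣; _-_; _+_; _≤_; 0ℚ; fromℚᵘ)
open import Data.Rational.Properties
open import Data.Rational.Solver using (module +-*-Solver)
import Data.Rational.Unnormalised as U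
import Data.Rational.Unnormalised.Properties as UP
open import Data.Product using (_,_)
open import Relation.Binary.PropositionalEquality

val-∨-+-∧ : ∀ a b → val (a B.∨ b) N.+ val (a B.∧ b) ≡ val a N.+ val b
val-∨-+-∧ true  true  = refl
val-∨-+-∧ true  false = refl
val-∨-+-∧ false true  = refl
val-∨-+-∧ false false = refl

count-∨-+-∧ : ∀ e e' n → count (e ∨ₑ e') n N.+ count (e ∧ₑ e') n ≡ count e n N.+ count e' n
count-∨-+-∧ e e' zero    = refl
count-∨-+-∧ e e' (suc n) = begin
  (x N.+ p) N.+ (y N.+ q) ≡⟨ interchange x p y q ⟩
  (x N.+ y) N.+ (p N.+ q) ≡⟨ cong₂ N._+_ (val-∨-+-∧ (e (suc n)) (e' (suc n))) (count-∨-+-∧ e e' n) ⟩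
  (u N.+ v) N.+ (r N.+ s) ≡⟨ interchange u v r s ⟩
  (u N.+ r) N.+ (v N.+ s) ∎
  where
  open ≡-Reasoning
  x p y q u r v s : ℕ
  x = val ((e ∨ₑ e') (suc n)); p = count (e ∨ₑ e') n
  y = val ((e ∧ₑ e') (suc n)); q = count (e ∧ₑ e') n
  u = val (e (suc n));         r = count e n
  v = val (e' (suc n));        s = count e' n

fromℚᵘ-homo-+ : ∀ p q → fromℚᵘ (p U.+ q) ≡ fromℚᵘ p + fromℚᵘ q
fromℚᵘ-homo-+ p q = toℚᵘ-injective (UP.≃-trans (toℚᵘ-fromℚᵘ (p U.+ q))
  (UP.≃-sym (UP.≃-trans (toℚᵘ-homo-+ (fromℚᵘ p) (fromℚᵘ q))
                        (UP.+-cong (toℚᵘ-fromℚᵘ p) (toℚᵘ-fromℚᵘ q)))))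

/-distribʳ-+ : ∀ a b d → (+ a) / suc d + (+ b) / suc d ≡ (+ (a N.+ b)) / suc d
/-distribʳ-+ a b d = trans (sym (fromℚᵘ-homo-+ (U.mkℚᵘ (+ a) d) (U.mkℚᵘ (+ b) d)))
                           (fromℚᵘ-cong {U.mkℚᵘ (+ a) d U.+ U.mkℚᵘ (+ b) d} {U.mkℚᵘ (+ (a N.+ b)) d}
                                         (U.*≡* cross))
  where
  s : ℕ
  s = suc d
  cross : (+ a Z.* + s Z.+ + b Z.* + s) Z.* + s ≡ + (a N.+ b) Z.* (+ s Z.* + s)
  cross = trans (ZS.solve 3 (λ a b s → (a :* s :+ b :* s) :* s := (a :+ b) :* (s :* s)) refl (+ a) (+ b) (+ s))
                (cong (Z._* (+ s Z.* + s)) (sym (ZP.pos-+ a b)))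
    where open ZS

1/[2n]-four-times≡2/n : ∀ m → let q = (+ 1) / (2 N.* suc m) in (q + q) + (q + q) ≡ (+ 2) / suc m
1/[2n]-four-times≡2/n m = begin
  (q + q) + (q + q)      ≡⟨ cong₂ _+_ (/-distribʳ-+ 1 1 d) (/-distribʳ-+ 1 1 d) ⟩
  (+ 2) / k + (+ 2) / k  ≡⟨ /-distribʳ-+ 2 2 d ⟩
  (+ 4) / k              ≡⟨ fromℚᵘ-cong {U.mkℚᵘ (+ 4) d} {U.mkℚᵘ (+ 2) m} (U.*≡* (cong +_ (four-over-2n m))) ⟩
  (+ 2) / suc m          ∎
  where
  open ≡-Reasoning
  k d : ℕ
  k = 2 N.* suc m
  d = N.pred k
  q : ℚ
  q = (+ 1) / k
  four-over-2n : ∀ m → 4 N.* suc m ≡ 2 N.* (2 N.* suc m)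
  four-over-2n = solve 1 (λ m → con 4 :* (con 1 :+ m) := con 2 :* (con 2 :* (con 1 :+ m))) refl
    where open NS.+-*-Solver

Φ-∨-+-Φ-∧ : ∀ e e' n → Φ (e ∨ₑ e') n + Φ (e ∧ₑ e') n ≡ Φ e n + Φ e' n
Φ-∨-+-Φ-∧ e e' zero    = refl
Φ-∨-+-Φ-∧ e e' (suc n) = begin
  Φ (e ∨ₑ e') (suc n) + Φ (e ∧ₑ e') (suc n)
    ≡⟨ /-distribʳ-+ (count (e ∨ₑ e') (suc n)) (count (e ∧ₑ e') (suc n)) n ⟩
  (+ (count (e ∨ₑ e') (suc n) N.+ count (e ∧ₑ e') (suc n))) / suc n
    ≡⟨ cong (λ c → (+ c) / suc n) (count-∨-+-∧ e e' (suc n)) ⟩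
  (+ (count e (suc n) N.+ count e' (suc n))) / suc n
    ≡⟨ /-distribʳ-+ (count e (suc n)) (count e' (suc n)) n ⟨
  Φ e (suc n) + Φ e' (suc n) ∎
  where open ≡-Reasoning

ℙ-close-to-Φ : ∀ {e γ} → IsActualEvent e γ → ∀ n .{{_ : NonZero n}} {M} → γ n N.≤ M →
               ∣ ℙ e γ n - Φ e M ∣ ≤ (+ 1) / n
ℙ-close-to-Φ {e} {γ} (_ , settles) n {M} γn≤M =
  subst₂ (λ i j → ∣ Φ e i - Φ e j ∣ ≤ (+ 1) / n)
         (NP.+-identityʳ (γ n)) (NP.m+[n∸m]≡n γn≤M)
         (settles n 0 (M N.∸ γ n))

∣[a+b]-[c+d]∣≤∑∣deviation∣ : ∀ a b c d a' b' c' d' → a' + b' ≡ c' + d' →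
  ∣ (a + b) - (c + d) ∣ ≤ (∣ a - a' ∣ + ∣ b - b' ∣) + (∣ c - c' ∣ + ∣ d - d' ∣)
∣[a+b]-[c+d]∣≤∑∣deviation∣ a b c d a' b' c' d' a'+b'≡c'+d' = begin
  ∣ (a + b) - (c + d) ∣
    ≡⟨ cong ∣_∣ regroup ⟩
  ∣ ((a - a') + (b - b')) - ((c - c') + (d - d')) ∣
    ≤⟨ ∣p-q∣≤∣p∣+∣q∣ ((a - a') + (b - b')) ((c - c') + (d - d')) ⟩
  ∣ (a - a') + (b - b') ∣ + ∣ (c - c') + (d - d') ∣
    ≤⟨ +-mono-≤ (∣p+q∣≤∣p∣+∣q∣ (a - a') (b - b')) (∣p+q∣≤∣p∣+∣q∣ (c - c') (d - d')) ⟩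
  (∣ a - a' ∣ + ∣ b - b' ∣) + (∣ c - c' ∣ + ∣ d - d' ∣) ∎
  where
  open ≤-Reasoning
  r : ℚ
  r = ((a - a') + (b - b')) - ((c - c') + (d - d'))
  regroup : (a + b) - (c + d) ≡ r
  regroup = begin-equality
    (a + b) - (c + d)                   ≡⟨ solve 8 (λ a b c d a' b' c' d' →
                                             (a :+ b) :- (c :+ d) :=
                                             (((a :- a') :+ (b :- b')) :- ((c :- c') :+ (d :- d')))
                                               :+ ((a' :+ b') :- (c' :+ d')))
                                           refl a b c d a' b' c' d' ⟩
    r + ((a' + b') - (c' + d'))         ≡⟨ cong (λ t → r + (t - (c' + d'))) a'+b'≡c'+d' ⟩
    r + ((c' + d') - (c' + d'))         ≡⟨ cong (λ t → r + t) (+-inverseʳ (c' + d')) ⟩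
    r + 0ℚ                              ≡⟨ +-identityʳ r ⟩
    r                                   ∎
    where open +-*-Solver

mainTheorem10 : (e e' : PotentialEvent) (α β γ δ : ℕ → ℕ) →
    IsActualEvent e α → IsActualEvent e' β →
    IsActualEvent (e ∧ₑ e') γ → IsActualEvent (e ∨ₑ e') δ →
    (ℙ (e ∨ₑ e') δ +ℝ ℙ (e ∧ₑ e') γ) =ℝ (ℙ e α +ℝ ℙ e' β)
mainTheorem10 e e' α β γ δ hα hβ hγ hδ (suc m) = begin
  ∣ (ℙ (e ∨ₑ e') δ k + ℙ (e ∧ₑ e') γ k) - (ℙ e α k + ℙ e' β k) ∣
    ≤⟨ ∣[a+b]-[c+d]∣≤∑∣deviation∣ (ℙ (e ∨ₑ e') δ k) (ℙ (e ∧ₑ e') γ k) (ℙ e α k) (ℙ e' β k)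
                                  (Φ (e ∨ₑ e') M) (Φ (e ∧ₑ e') M) (Φ e M) (Φ e' M)
                                  (Φ-∨-+-Φ-∧ e e' M) ⟩
  (∣ ℙ (e ∨ₑ e') δ k - Φ (e ∨ₑ e') M ∣ + ∣ ℙ (e ∧ₑ e') γ k - Φ (e ∧ₑ e') M ∣)
    + (∣ ℙ e α k - Φ e M ∣ + ∣ ℙ e' β k - Φ e' M ∣)
    ≤⟨ +-mono-≤ (+-mono-≤ (ℙ-close-to-Φ hδ k D≤M) (ℙ-close-to-Φ hγ k G≤M))
                (+-mono-≤ (ℙ-close-to-Φ hα k A≤M) (ℙ-close-to-Φ hβ k B≤M)) ⟩
  ((+ 1) / k + (+ 1) / k) + ((+ 1) / k + (+ 1) / k)
    ≡⟨ 1/[2n]-four-times≡2/n m ⟩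
  (+ 2) / suc m ∎
  where
  open ≤-Reasoning
  k D G A B M : ℕ
  k = 2 N.* suc m
  D = δ k; G = γ k; A = α k; B = β k
  M = (D N.+ G) N.+ (A N.+ B)
  D≤M : D N.≤ M
  D≤M = NP.≤-trans (NP.m≤m+n D G) (NP.m≤m+n (D N.+ G) (A N.+ B))
  G≤M : G N.≤ M
  G≤M = NP.≤-trans (NP.m≤n+m G D) (NP.m≤m+n (D N.+ G) (A N.+ B))
  A≤M : A N.≤ M
  A≤M = NP.≤-trans (NP.m≤m+n A B) (NP.m≤n+m (A N.+ B) (D N.+ G))
  B≤M : B N.≤ M
  B≤M = NP.≤-trans (NP.m≤n+m B A) (NP.m≤n+m (A N.+ B) (D N.+ G))
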